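{- Let $M,A$ be two variables that $q$-commute, i.e. $AM=qMA$. Let $P(z,t)$ be a Catalan power series and let $(T_i)_{i\in\mathbb N^2}$ be its dual coefficients. Then $$T=\sum_{i=(i_1,i_2)\in\mathbb N^2}T_i\,M^{i_1}A^{i_2}$$ is the unique power series in $(M,A)$ solving the equation $A=P(M,T)$.
   Context: $q$ is a fixed parameter; all series are formal. A formal power series $P(z,t)$ is a Catalan power series if there is a power series $\tilde P(z,t)$ with $P(z,t)=t-z\tilde P(z,t)t^2$. The predual basis of $P$ is $\tilde e_i(z,t)=z^{i_1}\prod_{0\le j<i_2}P(q^jz,t)$ for $i=(i_1,i_2)\in\mathbb N^2$ (empty product $=1$); it is a basis of power series in $(z,t)$, and the dual coefficients $(T_i)_{i\in\mathbb N^2}$ of $P$ are the unique numbers with $\sum_{i}T_i\tilde e_i(z,t)=t$. A power series in $(M,A)$ is a series $\sum_{i,j\ge0}c_{ij}M^iA^j$, monomials always being written with $M$ to the left of $A$. If $P(z,t)=\sum p_{ij}z^it^j$, then $P(M,T)$ means $\sum p_{ij}M^iT^j$ (with $M$ written to the left). -}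

module Defs where

open import Level using (_⊔_)
open import Data.Nat as ℕ using (ℕ; zero; suc)
open import Data.Product using (Σ; _×_)
open import Algebra.Bundles using (CommutativeRing)

-- The same type is used for
-- commutative series in (z,t) and for series in the q-commuting
-- variables (M,A) (coefficient  f n m  of  M^n A^m, M written left of A).
module PS {c ℓ} (R : CommutativeRing c ℓ) where
  open CommutativeRing R

  Series : Set c
  Series = ℕ → ℕ → Carrier

  _≋_ : Series → Series → Set ℓ
  f ≋ g = ∀ n m → f n m ≈ g n m

  sumTo : ℕ → (ℕ → Carrier) → Carrier
  sumTo zero    f = 0#
  sumTo (suc n) f = sumTo n f + f n

  pow : Carrier → ℕ → Carrier
  pow x zero    = 1#
  pow x (suc k) = pow x k * x

  δ : ℕ → ℕ → Carrier
  δ zero    zero    = 1#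
  δ zero    (suc _) = 0#
  δ (suc _) zero    = 0#
  δ (suc a) (suc b) = δ a b

  mono : ℕ → ℕ → Series
  mono a b n m = δ a n * δ b m

  _⊖_ : Series → Series → Series
  (f ⊖ g) n m = f n m - g n m

  _⊛_ : Series → Series → Series
  (f ⊛ g) n m = sumTo (suc n) λ a → sumTo (suc m) λ b →
                  f a b * g (n ℕ.∸ a) (m ℕ.∸ b)

  zV tV : Series
  zV = mono 1 0
  tV = mono 0 1

  cpow : Series → ℕ → Series
  cpow f zero    = mono 0 0
  cpow f (suc k) = cpow f k ⊛ f

  IsCatalan : Series → Set (c ⊔ ℓ)
  IsCatalan P = Σ Series λ P̃ → P ≋ (tV ⊖ ((zV ⊛ P̃) ⊛ cpow tV 2))

  dilate : Carrier → ℕ → Series → Series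
  dilate q j P n m = pow q (j ℕ.* n) * P n m

  qProd : Carrier → Series → ℕ → Series
  qProd q P zero    = mono 0 0
  qProd q P (suc k) = qProd q P k ⊛ dilate q k P

  predual : Carrier → Series → ℕ → ℕ → Series
  predual q P i₁ i₂ = cpow zV i₁ ⊛ qProd q P i₂

  -- Since P has zero constant term,
  -- ẽ_(i₁,i₂) has total order ≥ i₁+i₂, so only i₁,i₂ ≤ n+m contribute:
  -- the truncated sum below is the exact coefficient of the formal sum.
  dualSum : Carrier → Series → Series → Series
  dualSum q P T n m =
    sumTo (suc (n ℕ.+ m)) λ i₁ → sumTo (suc (n ℕ.+ m)) λ i₂ →
      T i₁ i₂ * predual q P i₁ i₂ n m

  IsDualCoeffs : Carrier → Series → Series → Set ℓ
  IsDualCoeffs q P T = dualSum q P T ≋ tV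

  -- product: (M^a A^b)(M^c A^d) = q^{b c} M^{a+c} A^{b+d}
  _⊛q_ : Carrier → Series → Series → Series
  (q ⊛q f) g = λ n m → sumTo (suc n) λ a → sumTo (suc m) λ b →
                 pow q (b ℕ.* (n ℕ.∸ a)) * (f a b * g (n ℕ.∸ a) (m ℕ.∸ b))

  qpow : Carrier → Series → ℕ → Series
  qpow q f zero    = mono 0 0
  qpow q f (suc k) = (q ⊛q qpow q f k) f

  MV AV : Series
  MV = mono 1 0
  AV = mono 0 1

  -- P(M,T) = Σ_{i,j} p_ij M^i T^j  (M to the left).  For T with zero
  -- constant term, T^j has total order ≥ j, so the coefficient of
  -- M^n A^m only receives contributions from i ≤ n, j ≤ n+m; the
  -- truncated sum below is then the exact coefficient.
  subst : Carrier → Series → Series → Series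
  subst q P T n m =
    sumTo (suc n) λ i → sumTo (suc (n ℕ.+ m)) λ j →
      P i j * (q ⊛q qpow q MV i) (qpow q T j) n m

module Submission where

-- For a series X in (M,A) let  eval H = H(M,X) = Σ_ab H_ab M^a X^b.
-- Uniqueness: if X solves A = P(M,X), then eval sends P(z,t) G(qz,t) to
-- A · eval G, so by induction eval ẽ_(i₁,i₂) = M^i₁ A^i₂; applying eval to
-- t = Σ_i T_i ẽ_i  gives  X = T.  Existence: a Catalan series has P(0,t) = t,
-- so the equation determines the row of M^n in X from the rows below it,
-- and the row-by-row construction yields a solution, which then is T.

open import Defs
open import Algebra.Bundles using (CommutativeRing)
open import Data.Nat as ℕ using (ℕ; zero; suc; _∸_; _≤_; _<_; z≤n; s≤s)
import Data.Nat.Properties as NP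
open import Data.Product using (_×_; _,_)
open import Relation.Binary.PropositionalEquality as ≡ using (_≡_; _≢_)
open import Relation.Nullary using (yes; no; contradiction)

module FiniteSums {c ℓ} (R : CommutativeRing c ℓ) where
  open CommutativeRing R
  open PS R using (sumTo; δ)
  open import Relation.Binary.Reasoning.Setoid setoid
  open import Algebra.Properties.CommutativeSemigroup +-commutativeSemigroup
    using (interchange)

  sum-cong : ∀ n {f g : ℕ → Carrier} → (∀ k → f k ≈ g k) → sumTo n f ≈ sumTo n g
  sum-cong zero    f≈g = refl
  sum-cong (suc n) f≈g = +-cong (sum-cong n f≈g) (f≈g n)

  sum-cong-< : ∀ n {f g : ℕ → Carrier} → (∀ k → k < n → f k ≈ g k) →
               sumTo n f ≈ sumTo n g
  sum-cong-< zero    f≈g = refl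
  sum-cong-< (suc n) f≈g =
    +-cong (sum-cong-< n (λ k k<n → f≈g k (NP.m<n⇒m<1+n k<n))) (f≈g n NP.≤-refl)

  sum-zero : ∀ n {f : ℕ → Carrier} → (∀ k → k < n → f k ≈ 0#) → sumTo n f ≈ 0#
  sum-zero n f≈0 = trans (sum-cong-< n f≈0) (zeros n)
    where
    zeros : ∀ n → sumTo n (λ _ → 0#) ≈ 0#
    zeros zero    = refl
    zeros (suc n) = trans (+-identityʳ _) (zeros n)

  sum-+ : ∀ n (f g : ℕ → Carrier) →
          sumTo n (λ k → f k + g k) ≈ sumTo n f + sumTo n g
  sum-+ zero    f g = sym (+-identityˡ 0#)
  sum-+ (suc n) f g = trans (+-congʳ (sum-+ n f g)) (interchange _ _ _ _)

  *-sum : ∀ n x (f : ℕ → Carrier) → x * sumTo n f ≈ sumTo n (λ k → x * f k)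
  *-sum zero    x f = zeroʳ x
  *-sum (suc n) x f = trans (distribˡ x _ _) (+-congʳ (*-sum n x f))

  sum-* : ∀ n x (f : ℕ → Carrier) → sumTo n f * x ≈ sumTo n (λ k → f k * x)
  sum-* zero    x f = zeroˡ x
  sum-* (suc n) x f = trans (distribʳ x _ _) (+-congʳ (sum-* n x f))

  sum-swap : ∀ n m (f : ℕ → ℕ → Carrier) →
    sumTo n (λ i → sumTo m (λ j → f i j)) ≈ sumTo m (λ j → sumTo n (λ i → f i j))
  sum-swap zero    m f = sym (sum-zero m (λ _ _ → refl))
  sum-swap (suc n) m f = begin
    sumTo n (λ i → sumTo m (λ j → f i j)) + sumTo m (λ j → f n j)
      ≈⟨ +-congʳ (sum-swap n m f) ⟩
    sumTo m (λ j → sumTo n (λ i → f i j)) + sumTo m (λ j → f n j)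
      ≈⟨ sum-+ m _ _ ⟨
    sumTo m (λ j → sumTo n (λ i → f i j) + f n j) ∎

  sum-unfoldˡ : ∀ n (f : ℕ → Carrier) →
                sumTo (suc n) f ≈ f 0 + sumTo n (λ k → f (suc k))
  sum-unfoldˡ zero    f = trans (+-identityˡ _) (sym (+-identityʳ _))
  sum-unfoldˡ (suc n) f = trans (+-congʳ (sum-unfoldˡ n f)) (+-assoc _ _ _)

  sum-δ : ∀ n k (f : ℕ → Carrier) → k < n → sumTo n (λ i → δ k i * f i) ≈ f k
  sum-δ (suc n) zero f _ = begin
    sumTo (suc n) (λ i → δ 0 i * f i)
      ≈⟨ sum-unfoldˡ n _ ⟩
    1# * f 0 + sumTo n (λ i → 0# * f (suc i))
      ≈⟨ +-cong (*-identityˡ _) (sum-zero n (λ i _ → zeroˡ _)) ⟩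
    f 0 + 0#
      ≈⟨ +-identityʳ _ ⟩
    f 0 ∎
  sum-δ (suc n) (suc k) f (s≤s k<n) = begin
    sumTo (suc n) (λ i → δ (suc k) i * f i)
      ≈⟨ sum-unfoldˡ n _ ⟩
    0# * f 0 + sumTo n (λ i → δ k i * f (suc i))
      ≈⟨ +-cong (zeroˡ _) (sum-δ n k _ k<n) ⟩
    0# + f (suc k)
      ≈⟨ +-identityˡ _ ⟩
    f (suc k) ∎

  sum-extend : ∀ N N' (f : ℕ → Carrier) → N ≤ N' → (∀ k → N ≤ k → f k ≈ 0#) →
               sumTo N' f ≈ sumTo N f
  sum-extend N N' f N≤N' f≈0 =
    ≡.subst (λ z → sumTo z f ≈ sumTo N f) (NP.m+[n∸m]≡n N≤N') (extendBy (N' ∸ N))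
    where
    extendBy : ∀ j → sumTo (N ℕ.+ j) f ≈ sumTo N f
    extendBy zero    = reflexive (≡.cong (λ z → sumTo z f) (NP.+-identityʳ N))
    extendBy (suc j) = ≡.subst (λ z → sumTo z f ≈ sumTo N f) (≡.sym (NP.+-suc N j))
      (trans (+-cong (extendBy j) (f≈0 (N ℕ.+ j) (NP.m≤m+n N j))) (+-identityʳ _))

  sum-dropPrefix : ∀ a N (f : ℕ → Carrier) → (∀ k → k < a → f k ≈ 0#) →
                   sumTo (a ℕ.+ N) f ≈ sumTo N (λ k → f (a ℕ.+ k))
  sum-dropPrefix zero    N f f≈0 = refl
  sum-dropPrefix (suc a) N f f≈0 = begin
    sumTo (suc (a ℕ.+ N)) f
      ≈⟨ sum-unfoldˡ (a ℕ.+ N) f ⟩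
    f 0 + sumTo (a ℕ.+ N) (λ k → f (suc k))
      ≈⟨ +-cong (f≈0 0 (s≤s z≤n)) (sum-dropPrefix a N _ (λ k k<a → f≈0 (suc k) (s≤s k<a))) ⟩
    0# + sumTo N (λ k → f (suc (a ℕ.+ k)))
      ≈⟨ +-identityˡ _ ⟩
    sumTo N (λ k → f (suc a ℕ.+ k)) ∎

  sum-reverse : ∀ n (f : ℕ → Carrier) → sumTo (suc n) f ≈ sumTo (suc n) (λ a → f (n ∸ a))
  sum-reverse zero    f = refl
  sum-reverse (suc n) f = begin
    sumTo (suc n) f + f (suc n)                   ≈⟨ +-congʳ (sum-reverse n f) ⟩
    sumTo (suc n) (λ a → f (n ∸ a)) + f (suc n)   ≈⟨ +-comm _ _ ⟩
    f (suc n) + sumTo (suc n) (λ a → f (n ∸ a))   ≈⟨ sum-unfoldˡ (suc n) _ ⟨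
    sumTo (suc (suc n)) (λ a → f (suc n ∸ a))     ∎

  -- Σ_{s≤n} Σ_{a≤s} F a (s-a) = Σ_{a≤n} Σ_{k≤n-a} F a k :
  -- both enumerate the pairs (a,k) with a + k ≤ n
  sum-triangle : ∀ n (F : ℕ → ℕ → Carrier) →
    sumTo (suc n) (λ s → sumTo (suc s) (λ a → F a (s ∸ a))) ≈
    sumTo (suc n) (λ a → sumTo (suc (n ∸ a)) (λ k → F a k))
  sum-triangle zero    F = refl
  sum-triangle (suc n) F = begin
    sumTo (suc n) (λ s → sumTo (suc s) (λ a → F a (s ∸ a)))
      + (sumTo (suc n) (λ a → F a (suc n ∸ a)) + F (suc n) (n ∸ n))
      ≈⟨ +-congʳ (sum-triangle n F) ⟩
    sumTo (suc n) (λ a → sumTo (suc (n ∸ a)) (λ k → F a k))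
      + (sumTo (suc n) (λ a → F a (suc n ∸ a)) + F (suc n) (n ∸ n))
      ≈⟨ +-assoc _ _ _ ⟨
    (sumTo (suc n) (λ a → sumTo (suc (n ∸ a)) (λ k → F a k))
      + sumTo (suc n) (λ a → F a (suc n ∸ a))) + F (suc n) (n ∸ n)
      ≈⟨ +-cong (sym (sum-+ (suc n) _ _)) lastRow ⟩
    sumTo (suc n) (λ a → sumTo (suc (n ∸ a)) (λ k → F a k) + F a (suc n ∸ a))
      + sumTo (suc (suc n ∸ suc n)) (λ k → F (suc n) k)
      ≈⟨ +-congʳ (sum-cong-< (suc n) (λ a a≤n → growRow a (NP.≤-pred a≤n))) ⟩
    sumTo (suc n) (λ a → sumTo (suc (suc n ∸ a)) (λ k → F a k))
      + sumTo (suc (suc n ∸ suc n)) (λ k → F (suc n) k) ∎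
    where
    lastRow : F (suc n) (n ∸ n) ≈ sumTo (suc (n ∸ n)) (λ k → F (suc n) k)
    lastRow rewrite NP.n∸n≡0 n = sym (+-identityˡ _)
    growRow : ∀ a → a ≤ n → sumTo (suc (n ∸ a)) (λ k → F a k) + F a (suc n ∸ a) ≈
                            sumTo (suc (suc n ∸ a)) (λ k → F a k)
    growRow a a≤n rewrite NP.+-∸-assoc 1 a≤n = refl

  sum-triangle-swap : ∀ n (X : ℕ → ℕ → Carrier) →
    sumTo (suc n) (λ a → sumTo (suc (n ∸ a)) (λ k → X a k)) ≈
    sumTo (suc n) (λ k → sumTo (suc (n ∸ k)) (λ a → X a k))
  sum-triangle-swap n X = begin
    sumTo (suc n) (λ a → sumTo (suc (n ∸ a)) (λ k → X a k))
      ≈⟨ sum-triangle n X ⟨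
    sumTo (suc n) (λ s → sumTo (suc s) (λ a → X a (s ∸ a)))
      ≈⟨ sum-cong (suc n) (λ s → sum-reverse s _) ⟩
    sumTo (suc n) (λ s → sumTo (suc s) (λ k → X (s ∸ k) (s ∸ (s ∸ k))))
      ≈⟨ sum-cong (suc n) (λ s → sum-cong-< (suc s) (λ k k≤s →
           reflexive (≡.cong (X (s ∸ k)) (NP.m∸[m∸n]≡n (NP.≤-pred k≤s))))) ⟩
    sumTo (suc n) (λ s → sumTo (suc s) (λ k → X (s ∸ k) k))
      ≈⟨ sum-triangle n (λ k a → X a k) ⟩
    sumTo (suc n) (λ k → sumTo (suc (n ∸ k)) (λ a → X a k)) ∎

  sum-triangle² : ∀ n m (F : ℕ → ℕ → ℕ → ℕ → Carrier) →
    sumTo (suc n) (λ c' → sumTo (suc m) (λ d →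
      sumTo (suc c') (λ a → sumTo (suc d) (λ b → F a b (c' ∸ a) (d ∸ b))))) ≈
    sumTo (suc n) (λ a → sumTo (suc (n ∸ a)) (λ x →
      sumTo (suc m) (λ b → sumTo (suc (m ∸ b)) (λ y → F a b x y))))
  sum-triangle² n m F = begin
    sumTo (suc n) (λ c' → sumTo (suc m) (λ d →
      sumTo (suc c') (λ a → sumTo (suc d) (λ b → F a b (c' ∸ a) (d ∸ b)))))
      ≈⟨ sum-cong (suc n) (λ c' → sum-swap (suc m) (suc c') _) ⟩
    sumTo (suc n) (λ c' → sumTo (suc c') (λ a →
      sumTo (suc m) (λ d → sumTo (suc d) (λ b → F a b (c' ∸ a) (d ∸ b)))))
      ≈⟨ sum-cong (suc n) (λ c' → sum-cong (suc c') (λ a →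
           sum-triangle m (λ b y → F a b (c' ∸ a) y))) ⟩
    sumTo (suc n) (λ c' → sumTo (suc c') (λ a →
      sumTo (suc m) (λ b → sumTo (suc (m ∸ b)) (λ y → F a b (c' ∸ a) y))))
      ≈⟨ sum-triangle n (λ a x → sumTo (suc m) (λ b → sumTo (suc (m ∸ b)) (λ y → F a b x y))) ⟩
    sumTo (suc n) (λ a → sumTo (suc (n ∸ a)) (λ x →
      sumTo (suc m) (λ b → sumTo (suc (m ∸ b)) (λ y → F a b x y)))) ∎

module IndexArithmetic where
  open import Algebra.Properties.CommutativeSemigroup NP.+-commutativeSemigroup
    using (interchange)

  complement-< : ∀ {a b n m p r} → a ≤ n → b ≤ m → p ≤ a ℕ.+ b →
                 n ℕ.+ m < p ℕ.+ r → (n ∸ a) ℕ.+ (m ∸ b) < r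
  complement-< {a} {b} {n} {m} {p} {r} a≤n b≤m p≤a+b n+m<p+r =
    NP.+-cancelʳ-< (a ℕ.+ b) _ _ (begin-strict
      (n ∸ a) ℕ.+ (m ∸ b) ℕ.+ (a ℕ.+ b) ≡⟨ interchange (n ∸ a) (m ∸ b) a b ⟩
      (n ∸ a ℕ.+ a) ℕ.+ (m ∸ b ℕ.+ b)   ≡⟨ ≡.cong₂ ℕ._+_ (NP.m∸n+n≡m a≤n) (NP.m∸n+n≡m b≤m) ⟩
      n ℕ.+ m                           <⟨ n+m<p+r ⟩
      p ℕ.+ r                           ≤⟨ NP.+-monoˡ-≤ r p≤a+b ⟩
      a ℕ.+ b ℕ.+ r                     ≡⟨ NP.+-comm (a ℕ.+ b) r ⟩
      r ℕ.+ (a ℕ.+ b)                   ∎)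
    where open NP.≤-Reasoning

  squeeze : ∀ {s x v m} → s ≤ x → v ≤ m → x ℕ.+ m ≤ s ℕ.+ v → x ≤ s × m ≤ v
  squeeze s≤x v≤m x+m≤s+v =
    NP.≮⇒≥ (λ s<x → NP.<⇒≱ (NP.+-mono-<-≤ s<x v≤m) x+m≤s+v) ,
    NP.≮⇒≥ (λ v<m → NP.<⇒≱ (NP.+-mono-≤-< s≤x v<m) x+m≤s+v)

  ∸-comm : ∀ n a x → n ∸ a ∸ x ≡ n ∸ x ∸ a
  ∸-comm n a x = ≡.trans (NP.∸-+-assoc n a x)
    (≡.trans (≡.cong (n ∸_) (NP.+-comm a x)) (≡.sym (NP.∸-+-assoc n x a)))

  ∸-∸-cancel : ∀ n a c → a ≤ c → n ∸ a ∸ (c ∸ a) ≡ n ∸ c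
  ∸-∸-cancel n a c a≤c = ≡.trans (NP.∸-+-assoc n a (c ∸ a)) (≡.cong (n ∸_) (NP.m+[n∸m]≡n a≤c))

module SeriesBasics {c ℓ} (R : CommutativeRing c ℓ) where
  open CommutativeRing R
  open PS R
  open import Relation.Binary.Reasoning.Setoid setoid

  δ-≢ : ∀ {a b} → a ≢ b → δ a b ≈ 0#
  δ-≢ {zero}  {zero}  a≢b = contradiction ≡.refl a≢b
  δ-≢ {zero}  {suc b} a≢b = refl
  δ-≢ {suc a} {zero}  a≢b = refl
  δ-≢ {suc a} {suc b} a≢b = δ-≢ (λ a≡b → a≢b (≡.cong suc a≡b))

  δ-sym : ∀ a b → δ a b ≡ δ b a
  δ-sym zero    zero    = ≡.refl
  δ-sym zero    (suc b) = ≡.refl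
  δ-sym (suc a) zero    = ≡.refl
  δ-sym (suc a) (suc b) = δ-sym a b

  pow-+ : ∀ x a b → pow x (a ℕ.+ b) ≈ pow x a * pow x b
  pow-+ x zero    b = sym (*-identityˡ _)
  pow-+ x (suc a) b = begin
    pow x (a ℕ.+ b) * x       ≈⟨ *-congʳ (pow-+ x a b) ⟩
    (pow x a * pow x b) * x   ≈⟨ *-assoc _ _ _ ⟩
    pow x a * (pow x b * x)   ≈⟨ *-congˡ (*-comm _ _) ⟩
    pow x a * (x * pow x b)   ≈⟨ *-assoc _ _ _ ⟨
    (pow x a * x) * pow x b   ∎

  pow-1# : ∀ k → pow 1# k ≈ 1#
  pow-1# zero    = refl
  pow-1# (suc k) = trans (*-identityʳ _) (pow-1# k)

  -- shiftM a X = M^a X : the rows of X moved up by a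
  shiftM : ℕ → Series → Series
  shiftM zero    X = X
  shiftM (suc a) X zero    m = 0#
  shiftM (suc a) X (suc n) m = shiftM a X n m

  shiftM-≥ : ∀ a n m X → a ≤ n → shiftM a X n m ≡ X (n ∸ a) m
  shiftM-≥ zero    n       m X a≤n       = ≡.refl
  shiftM-≥ (suc a) (suc n) m X (s≤s a≤n) = shiftM-≥ a n m X a≤n

  shiftM-< : ∀ a n m X → n < a → shiftM a X n m ≡ 0#
  shiftM-< (suc a) zero    m X n<a       = ≡.refl
  shiftM-< (suc a) (suc n) m X (s≤s n<a) = shiftM-< a n m X n<a

  shiftM-+ : ∀ a n m X → shiftM a X (a ℕ.+ n) m ≡ X n m
  shiftM-+ zero    n m X = ≡.refl
  shiftM-+ (suc a) n m X = shiftM-+ a n m X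

  shiftM-cong : ∀ a {X Y} → X ≋ Y → shiftM a X ≋ shiftM a Y
  shiftM-cong zero    X≋Y = X≋Y
  shiftM-cong (suc a) X≋Y zero    m = refl
  shiftM-cong (suc a) X≋Y (suc n) m = shiftM-cong a X≋Y n m

  shiftM-mono : ∀ a i j → shiftM a (mono i j) ≋ mono (a ℕ.+ i) j
  shiftM-mono zero    i j n       m = refl
  shiftM-mono (suc a) i j zero    m = sym (zeroˡ _)
  shiftM-mono (suc a) i j (suc n) m = shiftM-mono a i j n m

  HasOrder : ℕ → Series → Set ℓ
  HasOrder p f = ∀ a b → a ℕ.+ b < p → f a b ≈ 0#

  order-1 : ∀ {f} → f 0 0 ≈ 0# → HasOrder 1 f
  order-1 f₀₀≈0 zero    zero    _         = f₀₀≈0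
  order-1 f₀₀≈0 zero    (suc b) (s≤s ())
  order-1 f₀₀≈0 (suc a) b       (s≤s ())

  AgreeBelow : ℕ → Series → Series → Set ℓ
  AgreeBelow N f g = ∀ n m → n < N → f n m ≈ g n m

-- The product of series in variables M, A with  A M = w M A  (the
-- commutative product of (z,t)-series is the case w = 1).
module QProduct {c ℓ} (R : CommutativeRing c ℓ) (w : CommutativeRing.Carrier R) where
  open CommutativeRing R
  open PS R
  open FiniteSums R
  open SeriesBasics R
  open IndexArithmetic
  open import Relation.Binary.Reasoning.Setoid setoid
  open import Algebra.Properties.CommutativeSemigroup *-commutativeSemigroup
    using (interchange)

  infixl 25 _∙_
  _∙_ : Series → Series → Series
  f ∙ g = (w ⊛q f) g

  ∙-cong : ∀ {f f' g g'} → f ≋ f' → g ≋ g' → f ∙ g ≋ f' ∙ g'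
  ∙-cong f≋f' g≋g' n m = sum-cong (suc n) (λ a → sum-cong (suc m) (λ b →
    *-congˡ (*-cong (f≋f' a b) (g≋g' (n ∸ a) (m ∸ b)))))

  qpow-cong : ∀ {f g} → f ≋ g → ∀ k → qpow w f k ≋ qpow w g k
  qpow-cong f≋g zero    = λ _ _ → refl
  qpow-cong f≋g (suc k) = ∙-cong (qpow-cong f≋g k) f≋g

  M^-∙ : ∀ a X → mono a 0 ∙ X ≋ shiftM a X
  M^-∙ a X n m = trans (sum-cong (suc n) onlyA⁰) selectRow
    where
    onlyA⁰ : ∀ i → sumTo (suc m) (λ j → pow w (j ℕ.* (n ∸ i)) * ((δ a i * δ 0 j) * X (n ∸ i) (m ∸ j)))
                   ≈ δ a i * X (n ∸ i) m
    onlyA⁰ i = begin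
      sumTo (suc m) (λ j → pow w (j ℕ.* (n ∸ i)) * ((δ a i * δ 0 j) * X (n ∸ i) (m ∸ j)))
        ≈⟨ sum-unfoldˡ m _ ⟩
      1# * ((δ a i * 1#) * X (n ∸ i) m)
        + sumTo m (λ j → pow w (suc j ℕ.* (n ∸ i)) * ((δ a i * 0#) * X (n ∸ i) (m ∸ suc j)))
        ≈⟨ +-cong (trans (*-identityˡ _) (*-congʳ (*-identityʳ _)))
                  (sum-zero m (λ j _ → trans (*-congˡ (trans (*-congʳ (zeroʳ _)) (zeroˡ _))) (zeroʳ _))) ⟩
      δ a i * X (n ∸ i) m + 0#
        ≈⟨ +-identityʳ _ ⟩
      δ a i * X (n ∸ i) m ∎
    selectRow : sumTo (suc n) (λ i → δ a i * X (n ∸ i) m) ≈ shiftM a X n m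
    selectRow with a ℕ.≤? n
    ... | yes a≤n = trans (sum-δ (suc n) a (λ i → X (n ∸ i) m) (s≤s a≤n))
                          (reflexive (≡.sym (shiftM-≥ a n m X a≤n)))
    ... | no  a≰n = trans (sum-zero (suc n) (λ i i≤n →
                      trans (*-congʳ (δ-≢ (λ a≡i → NP.<⇒≢ (NP.<-≤-trans i≤n (NP.≰⇒> a≰n)) (≡.sym a≡i))))
                            (zeroˡ _)))
                          (reflexive (≡.sym (shiftM-< a n m X (NP.≰⇒> a≰n))))

  ∙-identityˡ : ∀ X → mono 0 0 ∙ X ≋ X
  ∙-identityˡ = M^-∙ 0

  qpow-M : ∀ a → qpow w MV a ≋ mono a 0
  qpow-M zero    n m = refl
  qpow-M (suc a) n m = begin
    (qpow w MV a ∙ MV) n m  ≈⟨ ∙-cong {g = MV} (qpow-M a) (λ _ _ → refl) n m ⟩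
    (mono a 0 ∙ MV) n m     ≈⟨ M^-∙ a MV n m ⟩
    shiftM a MV n m         ≈⟨ shiftM-mono a 1 0 n m ⟩
    mono (a ℕ.+ 1) 0 n m    ≈⟨ reflexive (≡.cong (λ k → mono k 0 n m) (NP.+-comm a 1)) ⟩
    mono (suc a) 0 n m      ∎

  order-∙ : ∀ p r f g → HasOrder p f → HasOrder r g → HasOrder (p ℕ.+ r) (f ∙ g)
  order-∙ p r f g ord-f ord-g n m n+m<p+r =
    sum-zero (suc n) (λ a a≤n → sum-zero (suc m) (λ b b≤m → term a b (NP.≤-pred a≤n) (NP.≤-pred b≤m)))
    where
    term : ∀ a b → a ≤ n → b ≤ m → pow w (b ℕ.* (n ∸ a)) * (f a b * g (n ∸ a) (m ∸ b)) ≈ 0#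
    term a b a≤n b≤m with p ℕ.≤? a ℕ.+ b
    ... | yes p≤a+b = trans (*-congˡ (trans (*-congˡ (ord-g _ _ (complement-< a≤n b≤m p≤a+b n+m<p+r)))
                                            (zeroʳ _))) (zeroʳ _)
    ... | no  p≰a+b = trans (*-congˡ (trans (*-congʳ (ord-f a b (NP.≰⇒> p≰a+b))) (zeroˡ _))) (zeroʳ _)

  agree-∙ : ∀ N {f f' g g'} → AgreeBelow N f f' → AgreeBelow N g g' → AgreeBelow N (f ∙ g) (f' ∙ g')
  agree-∙ N f≈f' g≈g' n m n<N = sum-cong-< (suc n) (λ a a≤n → sum-cong (suc m) (λ b →
    *-congˡ (*-cong (f≈f' a b (NP.≤-<-trans (NP.≤-pred a≤n) n<N))
                    (g≈g' (n ∸ a) (m ∸ b) (NP.≤-<-trans (NP.m∸n≤m n a) n<N)))))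

  agree-qpow : ∀ N {f g} → AgreeBelow N f g → ∀ k → AgreeBelow N (qpow w f k) (qpow w g k)
  agree-qpow N f≈g zero    n m _ = refl
  agree-qpow N f≈g (suc k)       = agree-∙ N (agree-qpow N f≈g k) f≈g

  -- left multiplication by A:  A (M^n A^m) = w^n M^n A^(m+1)
  A∙ : Series → Series
  A∙ Y n zero    = 0#
  A∙ Y n (suc m) = pow w n * Y n m

  A∙-cong : ∀ {X Y} → X ≋ Y → A∙ X ≋ A∙ Y
  A∙-cong X≋Y n zero    = refl
  A∙-cong X≋Y n (suc m) = *-congˡ (X≋Y n m)

  A∙-one : AV ≋ A∙ (mono 0 0)
  A∙-one n       zero    = zeroʳ _
  A∙-one zero    (suc m) = sym (*-identityˡ _)
  A∙-one (suc n) (suc m) = trans (zeroˡ _) (sym (trans (*-congˡ (zeroˡ _)) (zeroʳ _)))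

  A∙-A^ : ∀ j → A∙ (mono 0 j) ≋ mono 0 (suc j)
  A∙-A^ j n       zero    = sym (zeroʳ _)
  A∙-A^ j zero    (suc m) = *-identityˡ _
  A∙-A^ j (suc n) (suc m) = trans (*-congˡ (zeroˡ _)) (trans (zeroʳ _) (sym (zeroˡ _)))

  A∙-∙ : ∀ X Y → A∙ X ∙ Y ≋ A∙ (X ∙ Y)
  A∙-∙ X Y n zero    = sum-zero (suc n) (λ i _ → trans (+-identityˡ _) (trans (*-congˡ (zeroˡ _)) (zeroʳ _)))
  A∙-∙ X Y n (suc m) = begin
    sumTo (suc n) (λ i → sumTo (suc (suc m)) (λ j →
      pow w (j ℕ.* (n ∸ i)) * (A∙ X i j * Y (n ∸ i) (suc m ∸ j))))
      ≈⟨ sum-cong (suc n) (λ i → sum-unfoldˡ (suc m) _) ⟩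
    sumTo (suc n) (λ i → 1# * (0# * Y (n ∸ i) (suc m))
      + sumTo (suc m) (λ j → pow w (suc j ℕ.* (n ∸ i)) * ((pow w i * X i j) * Y (n ∸ i) (m ∸ j))))
      ≈⟨ sum-cong-< (suc n) (λ i i≤n → trans (+-congʳ (trans (*-identityˡ _) (zeroˡ _)))
           (trans (+-identityˡ _) (sum-cong (suc m) (λ j → weights i j (NP.≤-pred i≤n))))) ⟩
    sumTo (suc n) (λ i → sumTo (suc m) (λ j →
      pow w n * (pow w (j ℕ.* (n ∸ i)) * (X i j * Y (n ∸ i) (m ∸ j)))))
      ≈⟨ sum-cong (suc n) (λ i → *-sum (suc m) _ _) ⟨
    sumTo (suc n) (λ i → pow w n * sumTo (suc m) (λ j →
      pow w (j ℕ.* (n ∸ i)) * (X i j * Y (n ∸ i) (m ∸ j))))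
      ≈⟨ *-sum (suc n) _ _ ⟨
    pow w n * (X ∙ Y) n m ∎
    where
    weights : ∀ i j → i ≤ n →
      pow w (suc j ℕ.* (n ∸ i)) * ((pow w i * X i j) * Y (n ∸ i) (m ∸ j)) ≈
      pow w n * (pow w (j ℕ.* (n ∸ i)) * (X i j * Y (n ∸ i) (m ∸ j)))
    weights i j i≤n = begin
      pow w ((n ∸ i) ℕ.+ j ℕ.* (n ∸ i)) * ((pow w i * X i j) * Y (n ∸ i) (m ∸ j))
        ≈⟨ *-cong (pow-+ w (n ∸ i) (j ℕ.* (n ∸ i))) (*-assoc _ _ _) ⟩
      (pow w (n ∸ i) * pow w (j ℕ.* (n ∸ i))) * (pow w i * (X i j * Y (n ∸ i) (m ∸ j)))
        ≈⟨ interchange _ _ _ _ ⟩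
      (pow w (n ∸ i) * pow w i) * (pow w (j ℕ.* (n ∸ i)) * (X i j * Y (n ∸ i) (m ∸ j)))
        ≈⟨ *-congʳ (trans (sym (pow-+ w (n ∸ i) i)) (reflexive (≡.cong (pow w) (NP.m∸n+n≡m i≤n)))) ⟩
      pow w n * (pow w (j ℕ.* (n ∸ i)) * (X i j * Y (n ∸ i) (m ∸ j))) ∎

  subst-cong : ∀ Q {X Y} → X ≋ Y → subst w Q X ≋ subst w Q Y
  subst-cong Q X≋Y n m = sum-cong (suc n) (λ i → sum-cong (suc (n ℕ.+ m)) (λ j →
    *-congˡ (∙-cong {f = qpow w MV i} (λ _ _ → refl) (qpow-cong X≋Y j) n m)))

  A^∙ : ℕ → Series → Series
  A^∙ zero    Y = Y
  A^∙ (suc k) Y = A^∙ k (A∙ Y)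

  A^∙-cong : ∀ k {X Y} → X ≋ Y → A^∙ k X ≋ A^∙ k Y
  A^∙-cong zero    X≋Y = X≋Y
  A^∙-cong (suc k) X≋Y = A^∙-cong k (A∙-cong X≋Y)

  A^∙-A^ : ∀ k j → A^∙ k (mono 0 j) ≋ mono 0 (k ℕ.+ j)
  A^∙-A^ zero    j     = λ _ _ → refl
  A^∙-A^ (suc k) j n m = begin
    A^∙ k (A∙ (mono 0 j)) n m    ≈⟨ A^∙-cong k (A∙-A^ j) n m ⟩
    A^∙ k (mono 0 (suc j)) n m   ≈⟨ A^∙-A^ k (suc j) n m ⟩
    mono 0 (k ℕ.+ suc j) n m     ≈⟨ reflexive (≡.cong (λ l → mono 0 l n m) (NP.+-suc k j)) ⟩
    mono 0 (suc k ℕ.+ j) n m     ∎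

module CommutativeProduct {c ℓ} (R : CommutativeRing c ℓ) where
  open CommutativeRing R
  open PS R
  open FiniteSums R
  open SeriesBasics R
  open IndexArithmetic
  open import Relation.Binary.Reasoning.Setoid setoid
  open import Algebra.Properties.CommutativeSemigroup *-commutativeSemigroup
    using (interchange)
  private module Q₁ = QProduct R 1#

  ⊛≋∙₁ : ∀ f g → (f ⊛ g) ≋ (f Q₁.∙ g)
  ⊛≋∙₁ f g n m = sum-cong (suc n) (λ a → sum-cong (suc m) (λ b →
    sym (trans (*-congʳ (pow-1# (b ℕ.* (n ∸ a)))) (*-identityˡ _))))

  ⊛-cong : ∀ {f f' g g'} → f ≋ f' → g ≋ g' → (f ⊛ g) ≋ (f' ⊛ g')
  ⊛-cong f≋f' g≋g' n m = sum-cong (suc n) (λ a → sum-cong (suc m) (λ b →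
    *-cong (f≋f' a b) (g≋g' (n ∸ a) (m ∸ b))))

  ⊛-congˡ : ∀ f {g g'} → g ≋ g' → (f ⊛ g) ≋ (f ⊛ g')
  ⊛-congˡ f = ⊛-cong {f = f} (λ _ _ → refl)

  ⊛-assoc : ∀ f g h → ((f ⊛ g) ⊛ h) ≋ (f ⊛ (g ⊛ h))
  ⊛-assoc f g h n m = begin
    sumTo (suc n) (λ c' → sumTo (suc m) (λ d →
      sumTo (suc c') (λ a → sumTo (suc d) (λ b → f a b * g (c' ∸ a) (d ∸ b))) * h (n ∸ c') (m ∸ d)))
      ≈⟨ sum-cong (suc n) (λ c' → sum-cong (suc m) (λ d →
           trans (sum-* (suc c') _ _) (sum-cong (suc c') (λ a → sum-* (suc d) _ _)))) ⟩
    sumTo (suc n) (λ c' → sumTo (suc m) (λ d → sumTo (suc c') (λ a → sumTo (suc d) (λ b →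
      (f a b * g (c' ∸ a) (d ∸ b)) * h (n ∸ c') (m ∸ d)))))
      ≈⟨ sum-cong (suc n) (λ c' → sum-cong (suc m) (λ d → sum-cong-< (suc c') (λ a a≤c' →
           sum-cong-< (suc d) (λ b b≤d → trans (*-assoc _ _ _) (*-congˡ (*-congˡ (reflexive
             (≡.sym (≡.cong₂ h (∸-∸-cancel n a c' (NP.≤-pred a≤c'))
                               (∸-∸-cancel m b d (NP.≤-pred b≤d))))))))))) ⟩
    sumTo (suc n) (λ c' → sumTo (suc m) (λ d → sumTo (suc c') (λ a → sumTo (suc d) (λ b →
      F a b (c' ∸ a) (d ∸ b)))))
      ≈⟨ sum-triangle² n m F ⟩
    sumTo (suc n) (λ a → sumTo (suc (n ∸ a)) (λ x → sumTo (suc m) (λ b → sumTo (suc (m ∸ b)) (λ y →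
      F a b x y))))
      ≈⟨ sum-cong (suc n) (λ a → sum-swap (suc (n ∸ a)) (suc m) _) ⟩
    sumTo (suc n) (λ a → sumTo (suc m) (λ b → sumTo (suc (n ∸ a)) (λ x → sumTo (suc (m ∸ b)) (λ y →
      F a b x y))))
      ≈⟨ sum-cong (suc n) (λ a → sum-cong (suc m) (λ b →
           trans (*-sum (suc (n ∸ a)) _ _) (sum-cong (suc (n ∸ a)) (λ x → *-sum (suc (m ∸ b)) _ _)))) ⟨
    sumTo (suc n) (λ a → sumTo (suc m) (λ b → f a b * (g ⊛ h) (n ∸ a) (m ∸ b))) ∎
    where
    F : ℕ → ℕ → ℕ → ℕ → Carrier
    F a b x y = f a b * (g x y * h (n ∸ a ∸ x) (m ∸ b ∸ y))

  ⊛-identityʳ : ∀ f → (f ⊛ mono 0 0) ≋ f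
  ⊛-identityʳ f n m = begin
    sumTo (suc n) (λ a → sumTo (suc m) (λ b → f a b * (δ 0 (n ∸ a) * δ 0 (m ∸ b))))
      ≈⟨ sum-cong-< (suc n) (λ a a≤n → sum-cong-< (suc m) (λ b b≤m → trans (*-comm _ _)
           (trans (*-congʳ (*-cong (reflexive (δ-complement n a (NP.≤-pred a≤n)))
                                   (reflexive (δ-complement m b (NP.≤-pred b≤m)))))
                  (*-assoc _ _ _)))) ⟩
    sumTo (suc n) (λ a → sumTo (suc m) (λ b → δ n a * (δ m b * f a b)))
      ≈⟨ sum-cong (suc n) (λ a → *-sum (suc m) _ _) ⟨
    sumTo (suc n) (λ a → δ n a * sumTo (suc m) (λ b → δ m b * f a b))
      ≈⟨ sum-δ (suc n) n _ NP.≤-refl ⟩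
    sumTo (suc m) (λ b → δ m b * f n b)
      ≈⟨ sum-δ (suc m) m _ NP.≤-refl ⟩
    f n m ∎
    where
    δ-complement : ∀ n a → a ≤ n → δ 0 (n ∸ a) ≡ δ n a
    δ-complement n       zero    _         = δ-sym 0 n
    δ-complement (suc n) (suc a) (s≤s a≤n) = δ-complement n a a≤n

  z^-⊛ : ∀ a X → (mono a 0 ⊛ X) ≋ shiftM a X
  z^-⊛ a X n m = trans (⊛≋∙₁ (mono a 0) X n m) (Q₁.M^-∙ a X n m)

  cpow-z : ∀ a → cpow zV a ≋ mono a 0
  cpow-z zero    n m = refl
  cpow-z (suc a) n m = begin
    (cpow zV a ⊛ zV) n m   ≈⟨ ⊛-cong {g = zV} (cpow-z a) (λ _ _ → refl) n m ⟩
    (mono a 0 ⊛ zV) n m    ≈⟨ z^-⊛ a zV n m ⟩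
    shiftM a zV n m        ≈⟨ shiftM-mono a 1 0 n m ⟩
    mono (a ℕ.+ 1) 0 n m   ≈⟨ reflexive (≡.cong (λ k → mono k 0 n m) (NP.+-comm a 1)) ⟩
    mono (suc a) 0 n m     ∎

  order-⊛ : ∀ p r f g → HasOrder p f → HasOrder r g → HasOrder (p ℕ.+ r) (f ⊛ g)
  order-⊛ p r f g ord-f ord-g a b a+b<p+r =
    trans (⊛≋∙₁ f g a b) (Q₁.order-∙ p r f g ord-f ord-g a b a+b<p+r)

  module PredualOrder (q : Carrier) (P : Series) (P₀₀≈0 : P 0 0 ≈ 0#) where
    order-qProd : ∀ k → HasOrder k (qProd q P k)
    order-qProd zero    a b ()
    order-qProd (suc k) a b a+b<1+k =
      order-⊛ k 1 (qProd q P k) (dilate q k P) (order-qProd k) order-dilate a b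
        (≡.subst (a ℕ.+ b <_) (NP.+-comm 1 k) a+b<1+k)
      where
      order-dilate : HasOrder 1 (dilate q k P)
      order-dilate a b a+b<1 = trans (*-congˡ (order-1 {P} P₀₀≈0 a b a+b<1)) (zeroʳ _)

    order-z^ : ∀ i → HasOrder i (cpow zV i)
    order-z^ i a b a+b<i = trans (cpow-z i a b) (trans (*-congʳ
      (δ-≢ (λ i≡a → NP.<⇒≢ (NP.≤-<-trans (NP.m≤m+n a b) a+b<i) (≡.sym i≡a)))) (zeroˡ _))

    order-predual : ∀ i j → HasOrder (i ℕ.+ j) (predual q P i j)
    order-predual i j = order-⊛ i j (cpow zV i) (qProd q P j) (order-z^ i) (order-qProd j)

    dualSum-upTo : ∀ T a b K → a ℕ.+ b ≤ K →
      sumTo (suc K) (λ i → sumTo (suc K) (λ j → T i j * predual q P i j a b)) ≈ dualSum q P T a b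
    dualSum-upTo T a b K a+b≤K =
      trans (sum-cong (suc K) (λ i → sum-extend (suc (a ℕ.+ b)) (suc K) _ (s≤s a+b≤K) (λ j a+b<j →
              vanish i j (NP.<-≤-trans a+b<j (NP.m≤n+m j i)))))
            (sum-extend (suc (a ℕ.+ b)) (suc K) _ (s≤s a+b≤K) (λ i a+b<i →
              sum-zero (suc (a ℕ.+ b)) (λ j _ → vanish i j (NP.<-≤-trans a+b<i (NP.m≤m+n i j)))))
      where
      vanish : ∀ i j → a ℕ.+ b < i ℕ.+ j → T i j * predual q P i j a b ≈ 0#
      vanish i j a+b<i+j = trans (*-congˡ (order-predual i j a b a+b<i+j)) (zeroʳ _)

  module Dilation (q : Carrier) where
    dilate-⊛ : ∀ k f g → dilate q k (f ⊛ g) ≋ (dilate q k f ⊛ dilate q k g)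
    dilate-⊛ k f g n m = trans (*-sum (suc n) _ _) (sum-cong-< (suc n) (λ a a≤n →
      trans (*-sum (suc m) _ _) (sum-cong (suc m) (λ b → weights a b (NP.≤-pred a≤n)))))
      where
      weights : ∀ a b → a ≤ n → pow q (k ℕ.* n) * (f a b * g (n ∸ a) (m ∸ b)) ≈
                (pow q (k ℕ.* a) * f a b) * (pow q (k ℕ.* (n ∸ a)) * g (n ∸ a) (m ∸ b))
      weights a b a≤n = begin
        pow q (k ℕ.* n) * (f a b * g (n ∸ a) (m ∸ b))
          ≈⟨ *-congʳ (reflexive (≡.cong (λ l → pow q (k ℕ.* l)) (≡.sym (NP.m+[n∸m]≡n a≤n)))) ⟩
        pow q (k ℕ.* (a ℕ.+ (n ∸ a))) * (f a b * g (n ∸ a) (m ∸ b))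
          ≈⟨ *-congʳ (trans (reflexive (≡.cong (pow q) (NP.*-distribˡ-+ k a (n ∸ a))))
                            (pow-+ q (k ℕ.* a) (k ℕ.* (n ∸ a)))) ⟩
        (pow q (k ℕ.* a) * pow q (k ℕ.* (n ∸ a))) * (f a b * g (n ∸ a) (m ∸ b))
          ≈⟨ interchange _ _ _ _ ⟩
        (pow q (k ℕ.* a) * f a b) * (pow q (k ℕ.* (n ∸ a)) * g (n ∸ a) (m ∸ b)) ∎

    dilate-dilate : ∀ k g → dilate q k (dilate q 1 g) ≋ dilate q (suc k) g
    dilate-dilate k g n m = begin
      pow q (k ℕ.* n) * (pow q (1 ℕ.* n) * g n m)
        ≈⟨ *-assoc _ _ _ ⟨
      (pow q (k ℕ.* n) * pow q (1 ℕ.* n)) * g n m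
        ≈⟨ *-congʳ (trans (*-comm _ _) (sym (pow-+ q (1 ℕ.* n) (k ℕ.* n)))) ⟩
      pow q (1 ℕ.* n ℕ.+ k ℕ.* n) * g n m
        ≈⟨ *-congʳ (reflexive (≡.cong (λ l → pow q (l ℕ.+ k ℕ.* n)) (NP.*-identityˡ n))) ⟩
      pow q (suc k ℕ.* n) * g n m ∎

    dilate-one : ∀ k → dilate q k (mono 0 0) ≋ mono 0 0
    dilate-one k zero    m = trans (*-congʳ (reflexive (≡.cong (pow q) (NP.*-zeroʳ k)))) (*-identityˡ _)
    dilate-one k (suc n) m = trans (*-congˡ (zeroˡ _)) (trans (zeroʳ _) (sym (zeroˡ _)))

    dilate-0 : ∀ g → dilate q 0 g ≋ g
    dilate-0 g n m = *-identityˡ _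

-- Evaluation of a (z,t)-series H at (M,X):  eval H = Σ H_ab M^a X^b.
module Evaluation {c ℓ} (R : CommutativeRing c ℓ) (q : CommutativeRing.Carrier R)
                  (X : PS.Series R) where
  open CommutativeRing R
  open PS R
  open FiniteSums R
  open SeriesBasics R
  open QProduct R q
  open import Relation.Binary.Reasoning.Setoid setoid

  X^ : ℕ → Series
  X^ = qpow q X

  evalUpTo : ℕ → Series → Series
  evalUpTo B H n m = sumTo (suc n) (λ a → sumTo (suc B) (λ b → H a b * X^ b (n ∸ a) m))

  eval : Series → Series
  eval H n m = evalUpTo (n ℕ.+ m) H n m

  eval-cong-local : ∀ {H H'} n m → (∀ a b → a ≤ n → b ≤ n ℕ.+ m → H a b ≈ H' a b) →
                    eval H n m ≈ eval H' n m
  eval-cong-local n m H≈H' = sum-cong-< (suc n) (λ a a≤n → sum-cong-< (suc (n ℕ.+ m)) (λ b b≤N →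
    *-congʳ (H≈H' a b (NP.≤-pred a≤n) (NP.≤-pred b≤N))))

  eval-cong : ∀ {H H'} → H ≋ H' → eval H ≋ eval H'
  eval-cong H≋H' n m = eval-cong-local n m (λ a b _ _ → H≋H' a b)

  subst≋eval : ∀ Q → subst q Q X ≋ eval Q
  subst≋eval Q n m = sum-cong-< (suc n) (λ i i≤n → sum-cong (suc (n ℕ.+ m)) (λ j → *-congˡ (begin
    (qpow q MV i ∙ X^ j) n m   ≈⟨ ∙-cong {g = X^ j} (qpow-M i) (λ _ _ → refl) n m ⟩
    (mono i 0 ∙ X^ j) n m      ≈⟨ M^-∙ i (X^ j) n m ⟩
    shiftM i (X^ j) n m        ≈⟨ reflexive (shiftM-≥ i n m (X^ j) (NP.≤-pred i≤n)) ⟩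
    X^ j (n ∸ i) m             ∎)))

  eval-combination : ∀ K (C : ℕ → ℕ → Carrier) (F : ℕ → ℕ → Series) n m →
    eval (λ a b → sumTo K (λ i → sumTo K (λ j → C i j * F i j a b))) n m ≈
    sumTo K (λ i → sumTo K (λ j → C i j * eval (F i j) n m))
  eval-combination K C F n m = begin
    sumTo (suc n) (λ a → sumTo (suc N) (λ b →
      sumTo K (λ i → sumTo K (λ j → C i j * F i j a b)) * X^ b (n ∸ a) m))
      ≈⟨ sum-cong (suc n) (λ a → sum-cong (suc N) (λ b → trans (sum-* K _ _)
           (sum-cong K (λ i → trans (sum-* K _ _) (sum-cong K (λ j → *-assoc _ _ _)))))) ⟩
    sumTo (suc n) (λ a → sumTo (suc N) (λ b → sumTo K (λ i → sumTo K (λ j → U i j a b))))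
      ≈⟨ sum-cong (suc n) (λ a → trans (sum-swap (suc N) K _) (sum-cong K (λ i → sum-swap (suc N) K _))) ⟩
    sumTo (suc n) (λ a → sumTo K (λ i → sumTo K (λ j → sumTo (suc N) (λ b → U i j a b))))
      ≈⟨ trans (sum-swap (suc n) K _) (sum-cong K (λ i → sum-swap (suc n) K _)) ⟩
    sumTo K (λ i → sumTo K (λ j → sumTo (suc n) (λ a → sumTo (suc N) (λ b → U i j a b))))
      ≈⟨ sum-cong K (λ i → sum-cong K (λ j →
           trans (*-sum (suc n) _ _) (sum-cong (suc n) (λ a → *-sum (suc N) _ _)))) ⟨
    sumTo K (λ i → sumTo K (λ j → C i j * eval (F i j) n m)) ∎
    where
    N : ℕ
    N = n ℕ.+ m
    U : ℕ → ℕ → ℕ → ℕ → Carrier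
    U i j a b = C i j * (F i j a b * X^ b (n ∸ a) m)

  -- Facts valid once X has no constant term, so that X^b has order ≥ b.
  module NoConstantTerm (X₀₀≈0 : X 0 0 ≈ 0#) where
    order-X^ : ∀ j → HasOrder j (X^ j)
    order-X^ zero    a b ()
    order-X^ (suc j) a b a+b<1+j =
      order-∙ j 1 (X^ j) X (order-X^ j) (order-1 {X} X₀₀≈0) a b
        (≡.subst (a ℕ.+ b <_) (NP.+-comm 1 j) a+b<1+j)

    evalUpTo-stable : ∀ B H n m → n ℕ.+ m ≤ B → evalUpTo B H n m ≈ eval H n m
    evalUpTo-stable B H n m n+m≤B = sum-cong (suc n) (λ a →
      sum-extend (suc (n ℕ.+ m)) (suc B) _ (s≤s n+m≤B) (λ b n+m<b →
        trans (*-congˡ (order-X^ b (n ∸ a) m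
                 (NP.<-≤-trans (s≤s (NP.+-monoˡ-≤ m (NP.m∸n≤m n a))) n+m<b)))
              (zeroʳ _)))

    evalUpTo-mono : ∀ B i j n m → i ≤ n → j ≤ B → evalUpTo B (mono i j) n m ≈ X^ j (n ∸ i) m
    evalUpTo-mono B i j n m i≤n j≤B = begin
      sumTo (suc n) (λ a → sumTo (suc B) (λ b → (δ i a * δ j b) * X^ b (n ∸ a) m))
        ≈⟨ sum-cong (suc n) (λ a → trans (sum-cong (suc B) (λ b → *-assoc _ _ _)) (sym (*-sum (suc B) _ _))) ⟩
      sumTo (suc n) (λ a → δ i a * sumTo (suc B) (λ b → δ j b * X^ b (n ∸ a) m))
        ≈⟨ sum-δ (suc n) i _ (s≤s i≤n) ⟩
      sumTo (suc B) (λ b → δ j b * X^ b (n ∸ i) m)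
        ≈⟨ sum-δ (suc B) j _ (s≤s j≤B) ⟩
      X^ j (n ∸ i) m ∎

    eval-one : eval (mono 0 0) ≋ mono 0 0
    eval-one n m = evalUpTo-mono (n ℕ.+ m) 0 0 n m z≤n z≤n

    eval-t : eval tV ≋ X
    eval-t n m = begin
      eval tV n m                      ≈⟨ evalUpTo-stable (suc (n ℕ.+ m)) tV n m (NP.n≤1+n _) ⟨
      evalUpTo (suc (n ℕ.+ m)) tV n m  ≈⟨ evalUpTo-mono (suc (n ℕ.+ m)) 0 1 n m z≤n (s≤s z≤n) ⟩
      (mono 0 0 ∙ X) n m               ≈⟨ ∙-identityˡ X n m ⟩
      X n m                            ∎

    eval-shiftM : ∀ a H → eval (shiftM a H) ≋ shiftM a (eval H)
    eval-shiftM a H n m with a ℕ.≤? n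
    ... | no a≰n = trans (sum-zero (suc n) (λ c c≤n → sum-zero (suc (n ℕ.+ m)) (λ b _ →
                     trans (*-congʳ (reflexive (shiftM-< a c b H (NP.<-≤-trans c≤n (NP.≰⇒> a≰n)))))
                           (zeroˡ _))))
                   (reflexive (≡.sym (shiftM-< a n m (eval H) (NP.≰⇒> a≰n))))
    ... | yes a≤n = ≡.subst (λ k → eval (shiftM a H) k m ≈ shiftM a (eval H) k m) (NP.m+[n∸m]≡n a≤n)
                      (trans (shifted (n ∸ a)) (reflexive (≡.sym (shiftM-+ a (n ∸ a) m (eval H)))))
      where
      shifted : ∀ n' → eval (shiftM a H) (a ℕ.+ n') m ≈ eval H n' m
      shifted n' = begin
        sumTo (suc (a ℕ.+ n')) (λ c' → sumTo (suc N) (λ b → shiftM a H c' b * X^ b (a ℕ.+ n' ∸ c') m))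
          ≈⟨ reflexive (≡.cong (λ k → sumTo k (λ c' → sumTo (suc N) (λ b →
               shiftM a H c' b * X^ b (a ℕ.+ n' ∸ c') m))) (≡.sym (NP.+-suc a n'))) ⟩
        sumTo (a ℕ.+ suc n') (λ c' → sumTo (suc N) (λ b → shiftM a H c' b * X^ b (a ℕ.+ n' ∸ c') m))
          ≈⟨ sum-dropPrefix a (suc n') _ (λ k k<a → sum-zero (suc N) (λ b _ →
               trans (*-congʳ (reflexive (shiftM-< a k b H k<a))) (zeroˡ _))) ⟩
        sumTo (suc n') (λ c' → sumTo (suc N) (λ b →
          shiftM a H (a ℕ.+ c') b * X^ b (a ℕ.+ n' ∸ (a ℕ.+ c')) m))
          ≈⟨ sum-cong (suc n') (λ c' → sum-cong (suc N) (λ b → *-cong (reflexive (shiftM-+ a c' b H))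
               (reflexive (≡.cong (λ k → X^ b k m) (NP.[m+n]∸[m+o]≡n∸o a n' c'))))) ⟩
        evalUpTo N H n' m
          ≈⟨ evalUpTo-stable N H n' m (NP.+-monoˡ-≤ m (NP.m≤n+m n' a)) ⟩
        eval H n' m ∎
        where
        N : ℕ
        N = a ℕ.+ n' ℕ.+ m

    module Solution (P : Series) (solves : AV ≋ subst q P X) where
      open CommutativeProduct R
      open Dilation q
      open IndexArithmetic
      open import Algebra.Properties.CommutativeSemigroup *-commutativeSemigroup
        using (x∙yz≈y∙xz; interchange)

      -- coefficient (x,m) of P(M,X) X^b, the sum over t-degrees truncated at B
      PX^ : ℕ → ℕ → ℕ → ℕ → Carrier
      PX^ b B x m = sumTo (suc x) (λ a → sumTo (suc B) (λ c' → P a c' * X^ (c' ℕ.+ b) (x ∸ a) m))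

      PX^-extend : ∀ b B B' x m → B ≤ B' → x ℕ.+ m ≤ B ℕ.+ b → PX^ b B' x m ≈ PX^ b B x m
      PX^-extend b B B' x m B≤B' x+m≤B+b = sum-cong (suc x) (λ a →
        sum-extend (suc B) (suc B') _ (s≤s B≤B') (λ k B<k → trans (*-congˡ (order-X^ (k ℕ.+ b) (x ∸ a) m
          (NP.≤-<-trans (NP.+-monoˡ-≤ m (NP.m∸n≤m x a)) (NP.≤-<-trans x+m≤B+b (NP.+-monoˡ-< b B<k)))))
          (zeroʳ _)))

      PX⁰≈A : ∀ B x m → x ℕ.+ m ≤ B → PX^ 0 B x m ≈ AV x m
      PX⁰≈A B x m x+m≤B = begin
        PX^ 0 B x m
          ≈⟨ PX^-extend 0 (x ℕ.+ m) B x m x+m≤B (NP.m≤m+n (x ℕ.+ m) 0) ⟩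
        PX^ 0 (x ℕ.+ m) x m
          ≈⟨ sum-cong (suc x) (λ a → sum-cong (suc (x ℕ.+ m)) (λ c' →
               reflexive (≡.cong (λ k → P a c' * X^ k (x ∸ a) m) (NP.+-identityʳ c')))) ⟩
        eval P x m
          ≈⟨ subst≋eval P x m ⟨
        subst q P X x m
          ≈⟨ solves x m ⟨
        AV x m ∎

      -- the weight q^(v (x-s)) of the product (M^s A^v)(M^(x-s) A^(m-v))
      W : ℕ → ℕ → ℕ → Carrier
      W x s v = pow q (v ℕ.* (x ∸ s))

      regroup : ∀ x m s a v (p y : Carrier) → a ≤ s →
        p * (W (x ∸ a) (s ∸ a) v * (y * X (x ∸ a ∸ (s ∸ a)) (m ∸ v))) ≈
        (p * y) * (W x s v * X (x ∸ s) (m ∸ v))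
      regroup x m s a v p y a≤s = begin
        p * (W (x ∸ a) (s ∸ a) v * (y * X (x ∸ a ∸ (s ∸ a)) (m ∸ v)))
          ≈⟨ reflexive (≡.cong (λ k → p * (pow q (v ℕ.* k) * (y * X k (m ∸ v)))) (∸-∸-cancel x a s a≤s)) ⟩
        p * (W x s v * (y * X (x ∸ s) (m ∸ v)))
          ≈⟨ *-congˡ (x∙yz≈y∙xz _ _ _) ⟩
        p * (y * (W x s v * X (x ∸ s) (m ∸ v)))
          ≈⟨ *-assoc _ _ _ ⟨
        (p * y) * (W x s v * X (x ∸ s) (m ∸ v)) ∎

      -- P(M,X) X^(b+1) = (P(M,X) X^b) X, on truncated coefficients
      PX^-step : ∀ b B x m → PX^ (suc b) B x m ≈
        sumTo (suc x) (λ s → sumTo (suc m) (λ v → PX^ b B s v * (W x s v * X (x ∸ s) (m ∸ v))))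
      PX^-step b B x m = begin
        PX^ (suc b) B x m
          ≈⟨ sum-cong (suc x) (λ a → sum-cong (suc B) (λ c' →
               *-congˡ (reflexive (≡.cong (λ k → X^ k (x ∸ a) m) (NP.+-suc c' b))))) ⟩
        sumTo (suc x) (λ a → sumTo (suc B) (λ c' → P a c' * (X^ (c' ℕ.+ b) ∙ X) (x ∸ a) m))
          ≈⟨ sum-cong (suc x) (λ a → sum-cong (suc B) (λ c' →
               trans (*-sum (suc (x ∸ a)) _ _) (sum-cong (suc (x ∸ a)) (λ u → *-sum (suc m) _ _)))) ⟩
        sumTo (suc x) (λ a → sumTo (suc B) (λ c' → sumTo (suc (x ∸ a)) (λ u → sumTo (suc m) (λ v →
          term a c' u v))))
          ≈⟨ sum-cong (suc x) (λ a → trans (sum-swap (suc B) (suc (x ∸ a)) _)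
               (sum-cong (suc (x ∸ a)) (λ u → sum-swap (suc B) (suc m) _))) ⟩
        sumTo (suc x) (λ a → sumTo (suc (x ∸ a)) (λ u → sumTo (suc m) (λ v → sumTo (suc B) (λ c' →
          term a c' u v))))
          ≈⟨ sum-triangle x (λ a u → sumTo (suc m) (λ v → sumTo (suc B) (λ c' → term a c' u v))) ⟨
        sumTo (suc x) (λ s → sumTo (suc s) (λ a → sumTo (suc m) (λ v → sumTo (suc B) (λ c' →
          term a c' (s ∸ a) v))))
          ≈⟨ sum-cong (suc x) (λ s → sum-cong-< (suc s) (λ a a≤s → sum-cong (suc m) (λ v →
               sum-cong (suc B) (λ c' → regroup x m s a v _ _ (NP.≤-pred a≤s))))) ⟩
        sumTo (suc x) (λ s → sumTo (suc s) (λ a → sumTo (suc m) (λ v → sumTo (suc B) (λ c' →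
          (P a c' * X^ (c' ℕ.+ b) (s ∸ a) v) * (W x s v * X (x ∸ s) (m ∸ v))))))
          ≈⟨ sum-cong (suc x) (λ s → sum-swap (suc s) (suc m) _) ⟩
        sumTo (suc x) (λ s → sumTo (suc m) (λ v → sumTo (suc s) (λ a → sumTo (suc B) (λ c' →
          (P a c' * X^ (c' ℕ.+ b) (s ∸ a) v) * (W x s v * X (x ∸ s) (m ∸ v))))))
          ≈⟨ sum-cong (suc x) (λ s → sum-cong (suc m) (λ v →
               trans (sum-* (suc s) _ _) (sum-cong (suc s) (λ a → sum-* (suc B) _ _)))) ⟨
        sumTo (suc x) (λ s → sumTo (suc m) (λ v → PX^ b B s v * (W x s v * X (x ∸ s) (m ∸ v)))) ∎
        where
        term : ℕ → ℕ → ℕ → ℕ → Carrier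
        term a c' u v = P a c' * (W (x ∸ a) u v * (X^ (c' ℕ.+ b) u v * X (x ∸ a ∸ u) (m ∸ v)))

      PX^≈AX^ : ∀ b B x m → x ℕ.+ m ≤ B ℕ.+ b → PX^ b B x m ≈ A∙ (X^ b) x m
      PX^≈AX^ zero    B x m x+m≤B = trans (PX⁰≈A B x m (≡.subst (x ℕ.+ m ≤_) (NP.+-identityʳ B) x+m≤B))
                                          (A∙-one x m)
      PX^≈AX^ (suc b) B x m x+m≤B+b+1 = begin
        PX^ (suc b) B x m
          ≈⟨ PX^-step b B x m ⟩
        sumTo (suc x) (λ s → sumTo (suc m) (λ v → PX^ b B s v * (W x s v * X (x ∸ s) (m ∸ v))))
          ≈⟨ sum-cong-< (suc x) (λ s s≤x → sum-cong-< (suc m) (λ v v≤m →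
               termwise s v (NP.≤-pred s≤x) (NP.≤-pred v≤m))) ⟩
        (A∙ (X^ b) ∙ X) x m
          ≈⟨ A∙-∙ (X^ b) X x m ⟩
        A∙ (X^ (suc b)) x m ∎
        where
        -- below degree B + b use the induction hypothesis; at the corner
        -- (x,m) itself the factor X₀₀ vanishes
        termwise : ∀ s v → s ≤ x → v ≤ m → PX^ b B s v * (W x s v * X (x ∸ s) (m ∸ v)) ≈
                    W x s v * (A∙ (X^ b) s v * X (x ∸ s) (m ∸ v))
        termwise s v s≤x v≤m with s ℕ.+ v ℕ.≤? B ℕ.+ b
        ... | yes s+v≤B+b = trans (*-congʳ (PX^≈AX^ b B s v s+v≤B+b)) (x∙yz≈y∙xz _ _ _)
        ... | no  s+v≰B+b = trans (vanishes _ _) (sym (vanishes _ _))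
          where
          x+m≤s+v : x ℕ.+ m ≤ s ℕ.+ v
          x+m≤s+v = NP.≤-trans (≡.subst (x ℕ.+ m ≤_) (NP.+-suc B b) x+m≤B+b+1) (NP.≰⇒> s+v≰B+b)
          corner : X (x ∸ s) (m ∸ v) ≈ 0#
          corner with squeeze s≤x v≤m x+m≤s+v
          ... | x≤s , m≤v = trans (reflexive (≡.cong₂ X (NP.m≤n⇒m∸n≡0 x≤s) (NP.m≤n⇒m∸n≡0 m≤v))) X₀₀≈0
          vanishes : ∀ u u' → u * (u' * X (x ∸ s) (m ∸ v)) ≈ 0#
          vanishes u u' = trans (*-congˡ (trans (*-congˡ corner) (zeroʳ _))) (zeroʳ _)

      -- eval (P(z,t) G(z,t)) = Σ_(x,y) G_xy M^x (P(M,X) X^y) : a reindexing,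
      -- pulling the commuting factors M^x to the front
      eval-P⊛ : ∀ G n m → eval (P ⊛ G) n m ≈
        sumTo (suc n) (λ x → sumTo (suc (n ℕ.+ m)) (λ y → G x y * PX^ y (n ℕ.+ m ∸ y) (n ∸ x) m))
      eval-P⊛ G n m = begin
        sumTo (suc n) (λ c' → sumTo (suc N) (λ d → (P ⊛ G) c' d * X^ d (n ∸ c') m))
          ≈⟨ sum-cong (suc n) (λ c' → sum-cong (suc N) (λ d →
               trans (sum-* (suc c') _ _) (sum-cong (suc c') (λ a → sum-* (suc d) _ _)))) ⟩
        sumTo (suc n) (λ c' → sumTo (suc N) (λ d → sumTo (suc c') (λ a → sumTo (suc d) (λ b →
          (P a b * G (c' ∸ a) (d ∸ b)) * X^ d (n ∸ c') m))))
          ≈⟨ sum-cong (suc n) (λ c' → sum-cong (suc N) (λ d → sum-cong-< (suc c') (λ a a≤c' →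
               sum-cong-< (suc d) (λ b b≤d → trans (*-assoc _ _ _) (*-congˡ (*-congˡ (reflexive (≡.sym
                 (≡.cong₂ (λ k l → X^ k l m) (NP.m+[n∸m]≡n (NP.≤-pred b≤d))
                                             (∸-∸-cancel n a c' (NP.≤-pred a≤c'))))))))))) ⟩
        sumTo (suc n) (λ c' → sumTo (suc N) (λ d → sumTo (suc c') (λ a → sumTo (suc d) (λ b →
          F a b (c' ∸ a) (d ∸ b)))))
          ≈⟨ sum-triangle² n N F ⟩
        sumTo (suc n) (λ a → sumTo (suc (n ∸ a)) (λ x → sumTo (suc N) (λ b → sumTo (suc (N ∸ b)) (λ y →
          F a b x y))))
          ≈⟨ sum-triangle-swap n (λ a x → sumTo (suc N) (λ b → sumTo (suc (N ∸ b)) (λ y → F a b x y))) ⟩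
        sumTo (suc n) (λ x → sumTo (suc (n ∸ x)) (λ a → sumTo (suc N) (λ b → sumTo (suc (N ∸ b)) (λ y →
          F a b x y))))
          ≈⟨ sum-cong (suc n) (λ x → sum-cong (suc (n ∸ x)) (λ a → sum-triangle-swap N (λ b y → F a b x y))) ⟩
        sumTo (suc n) (λ x → sumTo (suc (n ∸ x)) (λ a → sumTo (suc N) (λ y → sumTo (suc (N ∸ y)) (λ b →
          F a b x y))))
          ≈⟨ sum-cong (suc n) (λ x → sum-swap (suc (n ∸ x)) (suc N) _) ⟩
        sumTo (suc n) (λ x → sumTo (suc N) (λ y → sumTo (suc (n ∸ x)) (λ a → sumTo (suc (N ∸ y)) (λ b →
          F a b x y))))
          ≈⟨ sum-cong (suc n) (λ x → sum-cong (suc N) (λ y → trans (sum-cong (suc (n ∸ x)) (λ a →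
               trans (sum-cong (suc (N ∸ y)) (λ b → pullG a b x y)) (sym (*-sum (suc (N ∸ y)) _ _))))
               (sym (*-sum (suc (n ∸ x)) _ _)))) ⟩
        sumTo (suc n) (λ x → sumTo (suc N) (λ y → G x y * PX^ y (N ∸ y) (n ∸ x) m)) ∎
        where
        N : ℕ
        N = n ℕ.+ m
        F : ℕ → ℕ → ℕ → ℕ → Carrier
        F a b x y = P a b * (G x y * X^ (b ℕ.+ y) (n ∸ a ∸ x) m)
        pullG : ∀ a b x y → F a b x y ≈ G x y * (P a b * X^ (b ℕ.+ y) (n ∸ x ∸ a) m)
        pullG a b x y = trans (x∙yz≈y∙xz _ _ _) (*-congˡ (*-congˡ (reflexive
          (≡.cong (λ k → X^ (b ℕ.+ y) k m) (∸-comm n a x)))))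

      eval-P⊛dilate : ∀ G → eval (P ⊛ dilate q 1 G) ≋ A∙ (eval G)
      eval-P⊛dilate G n m = begin
        eval (P ⊛ dilate q 1 G) n m
          ≈⟨ eval-P⊛ (dilate q 1 G) n m ⟩
        sumTo (suc n) (λ x → sumTo (suc N) (λ y → dilate q 1 G x y * PX^ y (N ∸ y) (n ∸ x) m))
          ≈⟨ sum-cong-< (suc n) (λ x x≤n → sum-cong-< (suc N) (λ y y≤N → *-congˡ
               (PX^≈AX^ y (N ∸ y) (n ∸ x) m (≡.subst ((n ∸ x) ℕ.+ m ≤_) (≡.sym (NP.m∸n+n≡m (NP.≤-pred y≤N)))
                 (NP.+-monoˡ-≤ m (NP.m∸n≤m n x)))))) ⟩
        sumTo (suc n) (λ x → sumTo (suc N) (λ y → dilate q 1 G x y * A∙ (X^ y) (n ∸ x) m))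
          ≈⟨ commuteA m ⟩
        A∙ (eval G) n m ∎
        where
        N : ℕ
        N = n ℕ.+ m
        -- q^x M^x A = A M^x
        commuteA : ∀ m → sumTo (suc n) (λ x → sumTo (suc (n ℕ.+ m)) (λ y →
                   dilate q 1 G x y * A∙ (X^ y) (n ∸ x) m)) ≈ A∙ (eval G) n m
        commuteA zero    = sum-zero (suc n) (λ x _ → sum-zero (suc (n ℕ.+ 0)) (λ y _ → zeroʳ _))
        commuteA (suc m) = begin
          sumTo (suc n) (λ x → sumTo (suc (n ℕ.+ suc m)) (λ y →
            (pow q (1 ℕ.* x) * G x y) * (pow q (n ∸ x) * X^ y (n ∸ x) m)))
            ≈⟨ sum-cong-< (suc n) (λ x x≤n → sum-cong (suc (n ℕ.+ suc m)) (λ y → weights x y (NP.≤-pred x≤n))) ⟩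
          sumTo (suc n) (λ x → sumTo (suc (n ℕ.+ suc m)) (λ y → pow q n * (G x y * X^ y (n ∸ x) m)))
            ≈⟨ trans (*-sum (suc n) _ _) (sum-cong (suc n) (λ x → *-sum (suc (n ℕ.+ suc m)) _ _)) ⟨
          pow q n * evalUpTo (n ℕ.+ suc m) G n m
            ≈⟨ *-congˡ (evalUpTo-stable (n ℕ.+ suc m) G n m (NP.+-monoʳ-≤ n (NP.n≤1+n m))) ⟩
          pow q n * eval G n m ∎
          where
          weights : ∀ x y → x ≤ n → (pow q (1 ℕ.* x) * G x y) * (pow q (n ∸ x) * X^ y (n ∸ x) m) ≈
                                     pow q n * (G x y * X^ y (n ∸ x) m)
          weights x y x≤n = begin
            (pow q (1 ℕ.* x) * G x y) * (pow q (n ∸ x) * X^ y (n ∸ x) m)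
              ≈⟨ interchange _ _ _ _ ⟩
            (pow q (1 ℕ.* x) * pow q (n ∸ x)) * (G x y * X^ y (n ∸ x) m)
              ≈⟨ *-congʳ (trans (sym (pow-+ q (1 ℕ.* x) (n ∸ x))) (reflexive (≡.cong (pow q)
                   (≡.trans (≡.cong (ℕ._+ (n ∸ x)) (NP.*-identityˡ x)) (NP.m+[n∸m]≡n x≤n))))) ⟩
            pow q n * (G x y * X^ y (n ∸ x) m) ∎

      eval-qProd⊛dilate : ∀ k G → eval (qProd q P k ⊛ dilate q k G) ≋ A^∙ k (eval G)
      eval-qProd⊛dilate zero    G = eval-cong (λ n m → trans (z^-⊛ 0 (dilate q 0 G) n m) (dilate-0 G n m))
      eval-qProd⊛dilate (suc k) G n m = begin
        eval ((qProd q P k ⊛ dilate q k P) ⊛ dilate q (suc k) G) n m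
          ≈⟨ eval-cong (⊛-assoc (qProd q P k) (dilate q k P) (dilate q (suc k) G)) n m ⟩
        eval (qProd q P k ⊛ (dilate q k P ⊛ dilate q (suc k) G)) n m
          ≈⟨ eval-cong (⊛-congˡ (qProd q P k) (λ a b → sym (trans (dilate-⊛ k P (dilate q 1 G) a b)
               (⊛-congˡ (dilate q k P) (dilate-dilate k G) a b)))) n m ⟩
        eval (qProd q P k ⊛ dilate q k (P ⊛ dilate q 1 G)) n m
          ≈⟨ eval-qProd⊛dilate k (P ⊛ dilate q 1 G) n m ⟩
        A^∙ k (eval (P ⊛ dilate q 1 G)) n m
          ≈⟨ A^∙-cong k (eval-P⊛dilate G) n m ⟩
        A^∙ k (A∙ (eval G)) n m ∎

      eval-qProd : ∀ k → eval (qProd q P k) ≋ mono 0 k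
      eval-qProd k n m = begin
        eval (qProd q P k) n m
          ≈⟨ eval-cong (λ a b → trans (⊛-congˡ (qProd q P k) (dilate-one k) a b)
                                      (⊛-identityʳ (qProd q P k) a b)) n m ⟨
        eval (qProd q P k ⊛ dilate q k (mono 0 0)) n m   ≈⟨ eval-qProd⊛dilate k (mono 0 0) n m ⟩
        A^∙ k (eval (mono 0 0)) n m                      ≈⟨ A^∙-cong k eval-one n m ⟩
        A^∙ k (mono 0 0) n m                             ≈⟨ A^∙-A^ k 0 n m ⟩
        mono 0 (k ℕ.+ 0) n m                             ≈⟨ reflexive (≡.cong (λ l → mono 0 l n m) (NP.+-identityʳ k)) ⟩
        mono 0 k n m                                     ∎

      eval-predual : ∀ i j → eval (predual q P i j) ≋ mono i j
      eval-predual i j n m = begin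
        eval (predual q P i j) n m
          ≈⟨ eval-cong (λ a b → trans (⊛-cong {g = qProd q P j} (cpow-z i) (λ _ _ → refl) a b)
                                      (z^-⊛ i (qProd q P j) a b)) n m ⟩
        eval (shiftM i (qProd q P j)) n m   ≈⟨ eval-shiftM i (qProd q P j) n m ⟩
        shiftM i (eval (qProd q P j)) n m   ≈⟨ shiftM-cong i (eval-qProd j) n m ⟩
        shiftM i (mono 0 j) n m             ≈⟨ shiftM-mono i 0 j n m ⟩
        mono (i ℕ.+ 0) j n m                ≈⟨ reflexive (≡.cong (λ l → mono l j n m) (NP.+-identityʳ i)) ⟩
        mono i j n m                        ∎

      -- Uniqueness: a solution X equals the dual coefficients T of P, since
      -- X = eval t = eval (Σ_i T_i ẽ_i) = Σ_i T_i M^i₁ A^i₂ = T.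
      module DualCoefficients (P₀₀≈0 : P 0 0 ≈ 0#) (T : Series) (dual : IsDualCoeffs q P T) where
        open PredualOrder q P P₀₀≈0

        eval-dualSum : eval (dualSum q P T) ≋ T
        eval-dualSum n m = begin
          eval (dualSum q P T) n m
            ≈⟨ eval-cong-local n m (λ a b a≤n b≤N → sym (dualSum-upTo T a b K (NP.+-mono-≤ a≤n b≤N))) ⟩
          eval (λ a b → sumTo (suc K) (λ i → sumTo (suc K) (λ j → T i j * predual q P i j a b))) n m
            ≈⟨ eval-combination (suc K) T (predual q P) n m ⟩
          sumTo (suc K) (λ i → sumTo (suc K) (λ j → T i j * eval (predual q P i j) n m))
            ≈⟨ sum-cong (suc K) (λ i → sum-cong (suc K) (λ j →
                 trans (*-congˡ (eval-predual i j n m)) (select i j))) ⟩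
          sumTo (suc K) (λ i → sumTo (suc K) (λ j → δ n i * (δ m j * T i j)))
            ≈⟨ sum-cong (suc K) (λ i → *-sum (suc K) _ _) ⟨
          sumTo (suc K) (λ i → δ n i * sumTo (suc K) (λ j → δ m j * T i j))
            ≈⟨ sum-δ (suc K) n _ (s≤s (NP.m≤m+n n N)) ⟩
          sumTo (suc K) (λ j → δ m j * T n j)
            ≈⟨ sum-δ (suc K) m _ (s≤s (NP.≤-trans (NP.m≤n+m m n) (NP.m≤n+m N n))) ⟩
          T n m ∎
          where
          N : ℕ
          N = n ℕ.+ m
          K : ℕ
          K = n ℕ.+ N
          select : ∀ i j → T i j * mono i j n m ≈ δ n i * (δ m j * T i j)
          select i j = begin
            T i j * (δ i n * δ j m)   ≈⟨ *-comm _ _ ⟩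
            (δ i n * δ j m) * T i j   ≈⟨ *-assoc _ _ _ ⟩
            δ i n * (δ j m * T i j)   ≈⟨ *-cong (reflexive (δ-sym i n)) (*-congʳ (reflexive (δ-sym j m))) ⟩
            δ n i * (δ m j * T i j)   ∎

        solution≋dual : X ≋ T
        solution≋dual n m = begin
          X n m                    ≈⟨ eval-t n m ⟨
          eval tV n m              ≈⟨ eval-cong (λ a b → sym (dual a b)) n m ⟩
          eval (dualSum q P T) n m ≈⟨ eval-dualSum n m ⟩
          T n m                    ∎

-- Existence: if P(0,t) = t, the equation  A = P(M,X)  determines the row n
-- of X (coefficients of M^n) from the rows below n, as
--   X_n = A_n - (terms P_ij M^i X^j with i ≥ 1)_n ,
-- so iterating this map from 0 converges row by row to a solution.
module Existence {c ℓ} (R : CommutativeRing c ℓ) (q : CommutativeRing.Carrier R)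
                 (P : PS.Series R) (row₀ : ∀ j → CommutativeRing._≈_ R (P 0 j) (PS.δ R 1 j)) where
  open CommutativeRing R
  open PS R
  open FiniteSums R
  open SeriesBasics R
  open QProduct R q
  open import Relation.Binary.Reasoning.Setoid setoid
  open import Algebra.Properties.Ring ring using (-0#≈0#)
  open import Algebra.Properties.Group +-group using (//-rightDividesˡ)

  higherTerms : Series → Series
  higherTerms X n m = sumTo n (λ i → sumTo (suc (n ℕ.+ m)) (λ j →
    P (suc i) j * qpow q X j (n ∸ suc i) m))

  improve : Series → Series
  improve X n m = AV n m - higherTerms X n m

  higherTerms-agree : ∀ N X Y → AgreeBelow N X Y → ∀ n m → n ≤ N →
                      higherTerms X n m ≈ higherTerms Y n m
  higherTerms-agree N X Y X≈Y n m n≤N = sum-cong-< n (λ i i<n → sum-cong (suc (n ℕ.+ m)) (λ j →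
    *-congˡ (agree-qpow N X≈Y j (n ∸ suc i) m
      (NP.<-≤-trans (NP.∸-monoʳ-< {o = 0} (s≤s z≤n) i<n) n≤N))))

  improve-agree : ∀ N X Y → AgreeBelow N X Y → AgreeBelow (suc N) (improve X) (improve Y)
  improve-agree N X Y X≈Y n m n<1+N =
    +-congˡ (-‿cong (higherTerms-agree N X Y X≈Y n m (NP.≤-pred n<1+N)))

  approx : ℕ → Series
  approx zero    = λ _ _ → 0#
  approx (suc k) = improve (approx k)

  approx-step : ∀ k → AgreeBelow k (approx k) (approx (suc k))
  approx-step zero    n m ()
  approx-step (suc k) = improve-agree k (approx k) (approx (suc k)) (approx-step k)

  approx-stable : ∀ k d → AgreeBelow k (approx k) (approx (d ℕ.+ k))
  approx-stable k zero    n m _   = refl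
  approx-stable k (suc d) n m n<k =
    trans (approx-stable k d n m n<k) (approx-step (d ℕ.+ k) n m (NP.<-≤-trans n<k (NP.m≤n+m k d)))

  solution : Series
  solution n m = approx (suc n) n m

  approx-solution : ∀ k → AgreeBelow k (approx k) solution
  approx-solution k n m n<k = sym (≡.subst (λ l → approx (suc n) n m ≈ approx l n m) (NP.m∸n+n≡m n<k)
    (approx-stable (suc n) (k ∸ suc n) n m NP.≤-refl))

  solution-fixed : ∀ n m → solution n m ≈ improve solution n m
  solution-fixed n m =
    +-congˡ (-‿cong (higherTerms-agree n (approx n) solution (approx-solution n) n m NP.≤-refl))

  solution₀₀ : solution 0 0 ≈ 0#
  solution₀₀ = trans (+-cong (zeroʳ 1#) -0#≈0#) (+-identityˡ 0#)

  -- since P(0,t) = t, the terms with i = 0 contribute X itself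
  leadingTerm : ∀ X → X 0 0 ≈ 0# → ∀ n m →
                sumTo (suc (n ℕ.+ m)) (λ j → P 0 j * qpow q X j n m) ≈ X n m
  leadingTerm X X₀₀≈0 n m with n ℕ.+ m in eq
  ... | zero    = begin
    0# + P 0 0 * qpow q X 0 n m   ≈⟨ +-identityˡ _ ⟩
    P 0 0 * qpow q X 0 n m        ≈⟨ trans (*-congʳ (row₀ 0)) (zeroˡ _) ⟩
    0#                            ≈⟨ X₀₀≈0 ⟨
    X 0 0                         ≡⟨ ≡.cong₂ X (NP.m+n≡0⇒m≡0 n eq) (NP.m+n≡0⇒n≡0 n eq) ⟨
    X n m                         ∎
  ... | suc k   = begin
    sumTo (suc (suc k)) (λ j → P 0 j * qpow q X j n m)   ≈⟨ sum-cong (suc (suc k)) (λ j → *-congʳ (row₀ j)) ⟩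
    sumTo (suc (suc k)) (λ j → δ 1 j * qpow q X j n m)   ≈⟨ sum-δ (suc (suc k)) 1 _ (s≤s (s≤s z≤n)) ⟩
    (mono 0 0 ∙ X) n m                                   ≈⟨ ∙-identityˡ X n m ⟩
    X n m                                                ∎

  solution-solves : AV ≋ subst q P solution
  solution-solves n m = sym (begin
    subst q P solution n m
      ≈⟨ subst≋eval P n m ⟩
    eval P n m
      ≈⟨ sum-unfoldˡ n _ ⟩
    sumTo (suc (n ℕ.+ m)) (λ j → P 0 j * qpow q solution j n m) + higherTerms solution n m
      ≈⟨ +-congʳ (trans (leadingTerm solution solution₀₀ n m) (solution-fixed n m)) ⟩
    (AV n m - higherTerms solution n m) + higherTerms solution n m
      ≈⟨ //-rightDividesˡ _ _ ⟩
    AV n m ∎)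
    where open Evaluation R q solution

-- A Catalan series has P(0,t) = t: the correction z P̃ t² has no z⁰ row.
module CatalanSeries {c ℓ} (R : CommutativeRing c ℓ) where
  open CommutativeRing R
  open PS R
  open FiniteSums R
  open import Algebra.Properties.Ring ring using (-0#≈0#)

  row₀-⊛ : ∀ f g → (∀ b → f 0 b ≈ 0#) → ∀ j → (f ⊛ g) 0 j ≈ 0#
  row₀-⊛ f g f₀≈0 j =
    trans (+-identityˡ _) (sum-zero (suc j) (λ b _ → trans (*-congʳ (f₀≈0 b)) (zeroˡ _)))

  catalan-row₀ : ∀ P → IsCatalan P → ∀ j → P 0 j ≈ δ 1 j
  catalan-row₀ P (P̃ , P≋t-zP̃t²) j = trans (P≋t-zP̃t² 0 j) (trans (+-cong (*-identityˡ _)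
    (trans (-‿cong (row₀-⊛ (zV ⊛ P̃) (cpow tV 2) (row₀-⊛ zV P̃ (λ b → zeroˡ _)) j)) -0#≈0#))
    (+-identityʳ _))

theorem3p2 : ∀ {c ℓ} (R : CommutativeRing c ℓ) (q : CommutativeRing.Carrier R)
               (P T : PS.Series R)
               → PS.IsCatalan R P
               → PS.IsDualCoeffs R q P T
               → (CommutativeRing._≈_ R (T 0 0) (CommutativeRing.0# R)
                  × PS._≋_ R (PS.AV R) (PS.subst R q P T))
                 × (∀ (S : PS.Series R)
                    → CommutativeRing._≈_ R (S 0 0) (CommutativeRing.0# R)
                    → PS._≋_ R (PS.AV R) (PS.subst R q P S)
                    → PS._≋_ R S T)
theorem3p2 R q P T catalan dual = (T₀₀≈0 , T-solves) , unique
  where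
  open CommutativeRing R
  open PS R
  open QProduct R q using (subst-cong)
  row₀ : ∀ j → P 0 j ≈ δ 1 j
  row₀ = CatalanSeries.catalan-row₀ R P catalan
  open Existence R q P row₀

  unique : ∀ S → S 0 0 ≈ 0# → AV ≋ subst q P S → S ≋ T
  unique S S₀₀≈0 S-solves = solution≋dual
    where
    open Evaluation.NoConstantTerm R q S S₀₀≈0
    open Solution P S-solves
    open DualCoefficients (row₀ 0) T dual

  -- the constructed solution is T, so T inherits its properties
  solution≋T : solution ≋ T
  solution≋T = unique solution solution₀₀ solution-solves

  T₀₀≈0 : T 0 0 ≈ 0#
  T₀₀≈0 = trans (sym (solution≋T 0 0)) solution₀₀

  T-solves : AV ≋ subst q P T
  T-solves n m = trans (solution-solves n m) (subst-cong P solution≋T n m)
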